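{- For all integers $1\le\hat c\le c$ we have $\delta(\hat c)\le\delta(c)$.
   Context: For integers $\ell,c\ge1$ let $W(\ell,c)$ be the set of sequences $\alpha=(\alpha_1,\dots,\alpha_d)$, $d=\ell+c-2$, with entries in $\{1,2\}$ having exactly $\ell-1$ ones and $c-1$ twos. Let $\nu_{i,s}:=1+|\{1\le j\le i:\alpha_j=s\}|$. Set $x_{1,0}:=x_{2,0}:=0$ and for $i=0,\dots,d$ in turn let $k_i:=1+\sum_{s\in\{1,2\}}\min_{j_1,j_2\ge0,\ j_1+j_2=\nu_{i,s}-1}(x_{s,j_1}+x_{s,j_2})$ and, if $i<d$, set $x_{s,\nu_{i,s}}:=k_i$ for $s=\alpha_{i+1}$; this defines $x_{1,0},\dots,x_{1,\ell-1}$ and $x_{2,0},\dots,x_{2,c-1}$. Put $\beta(\alpha):=1+\min_{j_1+j_2=c-1,\ j_1,j_2\ge0}(x_{2,j_1}+x_{2,j_2})$, $\delta(\alpha):=\min_{0\le j\le\ell-1}\frac{x_{1,j}+\beta(\alpha)}{j+1}$, $\delta(1):=1$, and for $c\ge2$, $\delta(c):=\sup\{\delta(\alpha):\ell\ge1,\ \alpha\in W(\ell,c),\ \alpha_{\ell+c-2}=2\}$. -}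

module Defs where

open import Data.Nat using (ℕ; zero; suc; _+_; _∸_; _≤_)
import Data.Nat as ℕ
open import Data.Integer using (+_)
open import Data.Rational using (ℚ; _/_; _⊓_; _<_)
open import Data.List using (List; []; _∷_; _∷ʳ_; zipWith; reverse; foldr; length; filter; last)
open import Data.Maybe using (Maybe; just)
open import Data.Empty using (⊥)
open import Data.Product using (_×_; _,_; proj₁; proj₂; ∃-syntax)
open import Relation.Binary.PropositionalEquality using (_≡_)
open import Relation.Nullary using (Dec; yes; no)

data Sym : Set where
  one two : Sym

_≟S_ : (a b : Sym) → Dec (a ≡ b)
one ≟S one = yes _≡_.refl
one ≟S two = no (λ ())
two ≟S one = no (λ ())
two ≟S two = yes _≡_.refl

count : Sym → List Sym → ℕ
count s α = length (filter (s ≟S_) α)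

minList : ℕ → List ℕ → ℕ
minList d [] = d
minList d (y ∷ ys) = foldr ℕ._⊓_ y ys

-- for xs = (x_0,…,x_m): min_{j1+j2=m} (x_{j1} + x_{j2})
minPair : List ℕ → ℕ
minPair xs = minList 0 (zipWith _+_ xs (reverse xs))

-- k = 1 + Σ_s min_{j1+j2=ν_s-1}(x_{s,j1}+x_{s,j2}),
-- where the current list for s is (x_{s,0},…,x_{s,ν_s-1})
kval : List ℕ → List ℕ → ℕ
kval xs1 xs2 = 1 + minPair xs1 + minPair xs2

run : List Sym → List ℕ → List ℕ → List ℕ × List ℕ
run [] a b = a , b
run (one ∷ r) a b = run r (a ∷ʳ kval a b) b
run (two ∷ r) a b = run r a (b ∷ʳ kval a b)

-- (x_{1,0},…,x_{1,ℓ-1}) and (x_{2,0},…,x_{2,c-1})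
xs₁ xs₂ : List Sym → List ℕ
xs₁ α = proj₁ (run α (0 ∷ []) (0 ∷ []))
xs₂ α = proj₂ (run α (0 ∷ []) (0 ∷ []))

β : List Sym → ℕ
β α = 1 + minPair (xs₂ α)

δaux : ℕ → ℕ → List ℕ → ℚ
δaux b j [] = + 0 / 1   -- unused: x_1 list is never empty
δaux b j (x ∷ []) = (+ (x + b)) / suc j
δaux b j (x ∷ y ∷ ys) = ((+ (x + b)) / suc j) ⊓ δaux b (suc j) (y ∷ ys)

δα : List Sym → ℚ
δα α = δaux (β α) 0 (xs₁ α)

-- α ∈ W(ℓ,c): entries in {1,2}, exactly ℓ-1 ones and c-1 twos
InW : ℕ → ℕ → List Sym → Set
InW ℓ c α = (count one α ≡ ℓ ∸ 1) × (count two α ≡ c ∸ 1)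

-- "q < δ(c)", where δ(1) = 1 and, for c ≥ 2, δ(c) is the supremum
-- (in the extended reals) of δ(α) over ℓ ≥ 1, α ∈ W(ℓ,c), α_d = 2.
-- q < sup S  iff  q < s for some s ∈ S.
BelowΔ : ℕ → ℚ → Set
BelowΔ zero q = ⊥  -- c = 0 is never used (hypothesis 1 ≤ ĉ ≤ c)
BelowΔ (suc zero) q = q < (+ 1 / 1)
BelowΔ (suc (suc c')) q =
  ∃[ ℓ ] ∃[ α ] ((1 ≤ ℓ) × InW ℓ (suc (suc c')) α × (last α ≡ just two) × (q < δα α))

module Submission where

-- It suffices to pass from c to c + 1.  From 1 to 2 this is the computation
-- δ(two ∷ []) = 2 > 1.  For c ≥ 2, a witness α ∈ W(ℓ,c) ending in 2 is
-- extended to α ∷ʳ two ∈ W(ℓ,c+1); the list x₁ is unchanged and x₂ only gains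
-- one entry k at its end, so it is enough to show that β, i.e. the minimal
-- pair sum min_{j₁+j₂=m} (x_{j₁} + x_{j₂}), does not decrease.
--
-- This rests on an invariant of the recursion: both lists x₁, x₂ are
-- nondecreasing and the next value k is at least every entry (the values k_i
-- never decrease).  For such a list appending k can only increase every pair
-- sum, because the pairs x_j + x_{m-j} become x_j + x_{m+1-j}.

open import Defs
open import Data.Nat using (ℕ; _≤_)
open import Data.Rational using (ℚ)

open import Data.Nat using (zero; suc; _+_; _≥_; _∸_; _⊓_; z≤n; s≤s; _≤′_; ≤′-reflexive; ≤′-step)
open import Data.Nat.Properties
  using (≤-refl; ≤-reflexive; ≤-trans; +-monoʳ-≤; +-monoˡ-≤; +-comm; +-identityʳ; ⊓-glb; m⊓n≤m; m⊓n≤n;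
         suc-injective; ≤⇒≤′)
open import Data.Integer using (+_; +≤+)
import Data.Integer.Properties as ℤ
import Data.Rational as ℚ
import Data.Rational.Properties as ℚP
open import Data.Rational.Unnormalised using (mkℚᵘ; *≤*) renaming (_≤_ to _≤ᵘ_)
import Data.Rational.Unnormalised.Properties as ℚᵘP
open import Data.List using (List; []; _∷_; _∷ʳ_; _++_; zipWith; reverse; foldr; length; filter; last)
open import Data.List.Properties using (unfold-reverse; reverse-++; length-reverse; length-++; filter-++; foldr-preservesᵇ)
open import Data.List.Relation.Unary.All as All using (All; []; _∷_)
open import Data.List.Relation.Unary.Linked using (Linked; [-]; _∷_)
open import Data.Maybe using (just)
open import Data.Product using (_×_; _,_; proj₁; proj₂; uncurry)
open import Relation.Binary.PropositionalEquality using (_≡_; refl; sym; trans; cong)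
open import Relation.Nullary.Decidable using (toWitness)
open import Data.Unit using (tt)

foldr-⊓-≤ : ∀ y ys → All (foldr _⊓_ y ys ≤_) (y ∷ ys)
foldr-⊓-≤ y [] = ≤-refl ∷ []
foldr-⊓-≤ y (z ∷ zs) with foldr-⊓-≤ y zs
... | y≥min ∷ zs≥min =
  ≤-trans (m⊓n≤n z _) y≥min ∷ m⊓n≤m z _ ∷ All.map (≤-trans (m⊓n≤n z _)) zs≥min

minList-≤ : ∀ d l → All (minList d l ≤_) l
minList-≤ d [] = []
minList-≤ d (y ∷ ys) = foldr-⊓-≤ y ys

≤-minList : ∀ {m} d {y ys} → All (m ≤_) (y ∷ ys) → m ≤ minList d (y ∷ ys)
≤-minList {m} d (m≤y ∷ m≤ys) = foldr-preservesᵇ {P = m ≤_} ⊓-glb m≤y m≤ys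

last-∷ʳ : ∀ {A : Set} (xs : List A) x → last (xs ∷ʳ x) ≡ just x
last-∷ʳ [] x = refl
last-∷ʳ (y ∷ []) x = refl
last-∷ʳ (y ∷ z ∷ zs) x = last-∷ʳ (z ∷ zs) x

reverse-∷ʳ : ∀ {A : Set} (xs : List A) x → reverse (xs ∷ʳ x) ≡ x ∷ reverse xs
reverse-∷ʳ xs x = reverse-++ xs (x ∷ [])

-- A lower bound m of the pair sums of x ∷ xs with r is at most c + x when c tops
-- the descending list r (it bounds the first pair sum x + r₀ ≤ x + c).
first-pair-≤ : ∀ {m c x} xs r → length (x ∷ xs) ≡ length r → Linked _≥_ (c ∷ r) →
               All (m ≤_) (zipWith _+_ (x ∷ xs) r) → m ≤ c + x
first-pair-≤ xs [] () _ _
first-pair-≤ {x = x} xs (y ∷ r) _ (y≤c ∷ _) (m≤x+y ∷ _) =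
  ≤-trans m≤x+y (≤-trans (+-monoʳ-≤ x y≤c) (≤-reflexive (+-comm x _)))

-- Shifting a descending list r one step to the right (prepending c ≥ r₀) only
-- increases the pair sums with xs; the new last pair k + z must be checked apart.
pair-sums-shift : ∀ {m k c z} xs r → length xs ≡ length r → Linked _≥_ (c ∷ r) →
                  last (c ∷ r) ≡ just z → All (m ≤_) (zipWith _+_ xs r) → m ≤ k + z →
                  All (m ≤_) (zipWith _+_ (xs ∷ʳ k) (c ∷ r))
pair-sums-shift [] [] _ _ refl _ m≤k+z = m≤k+z ∷ []
pair-sums-shift [] (y ∷ r) () _ _ _ _
pair-sums-shift (x ∷ xs) [] () _ _ _ _
pair-sums-shift (x ∷ xs) (y ∷ r) len (y≤c ∷ desc) lastEq (m≤x+y ∷ rest) m≤k+z =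
  ≤-trans m≤x+y (+-monoʳ-≤ x y≤c) ∷ pair-sums-shift xs r (suc-injective len) desc lastEq rest m≤k+z

minPair-snoc : ∀ k xs → Linked _≥_ (k ∷ reverse xs) → minPair xs ≤ minPair (xs ∷ʳ k)
minPair-snoc k [] _ = z≤n
minPair-snoc k (x ∷ xs) desc =
  ≤-trans (≤-minList 0 newPairs) (≤-reflexive (cong pairMin (sym (reverse-∷ʳ (x ∷ xs) k))))
  where
  r = reverse (x ∷ xs)
  pairMin : List ℕ → ℕ
  pairMin s = minList 0 (zipWith _+_ ((x ∷ xs) ∷ʳ k) s)
  len : length (x ∷ xs) ≡ length r
  len = sym (length-reverse (x ∷ xs))
  oldPairs : All (minPair (x ∷ xs) ≤_) (zipWith _+_ (x ∷ xs) r)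
  oldPairs = minList-≤ 0 _
  lastIsHead : last (k ∷ r) ≡ just x
  lastIsHead = trans (cong (λ s → last (k ∷ s)) (unfold-reverse x xs)) (last-∷ʳ (k ∷ reverse xs) x)
  newPairs : All (minPair (x ∷ xs) ≤_) (zipWith _+_ ((x ∷ xs) ∷ʳ k) (k ∷ r))
  newPairs =
    pair-sums-shift (x ∷ xs) r len desc lastIsHead oldPairs (first-pair-≤ xs r len desc oldPairs)

-- Both current lists, read backwards, descend from the next value kval a b:
-- each list is nondecreasing and kval a b is at least every entry so far.
Ordered : List ℕ × List ℕ → Set
Ordered (a , b) = Linked _≥_ (kval a b ∷ reverse a) × Linked _≥_ (kval a b ∷ reverse b)

raise : ∀ {k k' r} → k ≤ k' → Linked _≥_ (k ∷ r) → Linked _≥_ (k' ∷ r)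
raise k≤k' [-] = [-]
raise k≤k' (y≤k ∷ desc) = ≤-trans y≤k k≤k' ∷ desc

push : ∀ {k k'} xs → k ≤ k' → Linked _≥_ (k ∷ reverse xs) → Linked _≥_ (k' ∷ reverse (xs ∷ʳ k))
push {k} xs k≤k' desc rewrite reverse-∷ʳ xs k = k≤k' ∷ desc

ordered-one : ∀ a b → Ordered (a , b) → Ordered (a ∷ʳ kval a b , b)
ordered-one a b (desc-a , desc-b) = push a k≤k' desc-a , raise k≤k' desc-b
  where
  k≤k' : kval a b ≤ kval (a ∷ʳ kval a b) b
  k≤k' = +-monoˡ-≤ (minPair b) (+-monoʳ-≤ 1 (minPair-snoc _ a desc-a))

ordered-two : ∀ a b → Ordered (a , b) → Ordered (a , b ∷ʳ kval a b)
ordered-two a b (desc-a , desc-b) = raise k≤k' desc-a , push b k≤k' desc-b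
  where
  k≤k' : kval a b ≤ kval a (b ∷ʳ kval a b)
  k≤k' = +-monoʳ-≤ (1 + minPair a) (minPair-snoc _ b desc-b)

run-ordered : ∀ α a b → Ordered (a , b) → Ordered (run α a b)
run-ordered [] a b ord = ord
run-ordered (one ∷ α) a b ord = run-ordered α _ b (ordered-one a b ord)
run-ordered (two ∷ α) a b ord = run-ordered α a _ (ordered-two a b ord)

ordered-start : Ordered (0 ∷ [] , 0 ∷ [])
ordered-start = z≤n ∷ [-] , z≤n ∷ [-]

run-++ : ∀ α γ a b → run (α ++ γ) a b ≡ uncurry (run γ) (run α a b)
run-++ [] γ a b = refl
run-++ (one ∷ α) γ a b = run-++ α γ _ b
run-++ (two ∷ α) γ a b = run-++ α γ a _

fromℚᵘ-mono-≤ : ∀ {p q} → p ≤ᵘ q → ℚ.fromℚᵘ p ℚ.≤ ℚ.fromℚᵘ q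
fromℚᵘ-mono-≤ {p} {q} p≤q = ℚP.toℚᵘ-cancel-≤
  (ℚᵘP.≤-respʳ-≃ (ℚᵘP.≃-sym (ℚP.toℚᵘ-fromℚᵘ q)) (ℚᵘP.≤-respˡ-≃ (ℚᵘP.≃-sym (ℚP.toℚᵘ-fromℚᵘ p)) p≤q))

/-monoˡ-≤ : ∀ {m n} j → m ≤ n → (+ m) ℚ./ suc j ℚ.≤ (+ n) ℚ./ suc j
/-monoˡ-≤ {m} {n} j m≤n =
  fromℚᵘ-mono-≤ {mkℚᵘ (+ m) j} {mkℚᵘ (+ n) j} (*≤* (ℤ.*-monoʳ-≤-nonNeg (+ suc j) (+≤+ m≤n)))

δaux-mono : ∀ {b b'} → b ≤ b' → ∀ j l → δaux b j l ℚ.≤ δaux b' j l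
δaux-mono b≤b' j [] = ℚP.≤-refl
δaux-mono b≤b' j (x ∷ []) = /-monoˡ-≤ j (+-monoʳ-≤ x b≤b')
δaux-mono b≤b' j (x ∷ y ∷ ys) =
  ℚP.⊓-mono-≤ (/-monoˡ-≤ j (+-monoʳ-≤ x b≤b')) (δaux-mono b≤b' (suc j) (y ∷ ys))

-- Appending a two keeps x₁ and appends to x₂, so β and with it δ do not decrease.
δα-snoc-two : ∀ α → δα α ℚ.≤ δα (α ∷ʳ two)
δα-snoc-two α = begin
  δα α
    ≤⟨ δaux-mono (+-monoʳ-≤ 1 (minPair-snoc _ (xs₂ α) (proj₂ (run-ordered α _ _ ordered-start)))) 0 (xs₁ α) ⟩
  δaux (1 + minPair (xs₂ α ∷ʳ kval (xs₁ α) (xs₂ α))) 0 (xs₁ α)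
    ≡⟨ cong (λ p → δaux (1 + minPair (proj₂ p)) 0 (proj₁ p)) (sym (run-++ α (two ∷ []) _ _)) ⟩
  δα (α ∷ʳ two) ∎
  where open ℚP.≤-Reasoning

count-++ : ∀ s α γ → count s (α ++ γ) ≡ count s α + count s γ
count-++ s α γ = trans (cong length (filter-++ (s ≟S_) α γ)) (length-++ (filter (s ≟S_) α))

δ-two : (+ 1) ℚ./ 1 ℚ.< δα (two ∷ [])
δ-two = toWitness {a? = (+ 1) ℚ./ 1 ℚ.<? δα (two ∷ [])} tt

below-suc : ∀ c q → BelowΔ c q → BelowΔ (suc c) q
below-suc zero q ()
below-suc (suc zero) q q<1 = 1 , two ∷ [] , s≤s z≤n , (refl , refl) , refl , ℚP.<-trans q<1 δ-two
below-suc (suc (suc c)) q (ℓ , α , 1≤ℓ , (ones , twos) , _ , q<δα) =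
  ℓ , α ∷ʳ two , 1≤ℓ , (ones′ , twos′) , last-∷ʳ α two , ℚP.<-≤-trans q<δα (δα-snoc-two α)
  where
  ones′ : count one (α ∷ʳ two) ≡ ℓ ∸ 1
  ones′ = trans (count-++ one α (two ∷ [])) (trans (+-identityʳ _) ones)
  twos′ : count two (α ∷ʳ two) ≡ suc (suc c)
  twos′ = trans (count-++ two α (two ∷ [])) (trans (+-comm _ 1) (cong suc twos))

-- δ(ĉ) ≤ δ(c): climb from ĉ to c one step at a time.
lemma18 : (ĉ c : ℕ) → 1 ≤ ĉ → ĉ ≤ c → (q : ℚ) → BelowΔ ĉ q → BelowΔ c q
lemma18 ĉ c _ ĉ≤c q below = climb (≤⇒≤′ ĉ≤c)
  where
  climb : ∀ {c} → ĉ ≤′ c → BelowΔ c q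
  climb (≤′-reflexive refl) = below
  climb (≤′-step ĉ≤′c) = below-suc _ q (climb ĉ≤′c)
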